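{- For every permutation $\tau$, $$\mathrm{lmax}(\tau)=\sum_{\substack{\pi\in\mathfrak{S},\ |\pi|\ge1\\ \pi(|\pi|)=1}}(-1)^{|\pi|-1}\,\pi(\tau).$$
   Context: $\mathfrak{S}$ is the set of all permutations of $[1,n]$ for all $n\ge0$. For $\tau\in\mathfrak{S}_n$, a left-to-right maximum is an index $j$ with $\tau(i)<\tau(j)$ for all $i<j$; $\mathrm{lmax}(\tau)$ is their number. $\pi(\tau)$ denotes the number of classical occurrences of the pattern $\pi$ in $\tau$ (subsequences of $\tau$ order-isomorphic to $\pi$). -}

module Defs where

open import Data.Nat using (ℕ; zero; suc; _≤_)
open import Data.Fin using (Fin; zero; suc; fromℕ; _<_; _<?_) renaming (_≟_ to _≟ᶠ_)
open import Data.Fin.Properties using (all?)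
open import Data.Vec using (Vec; []; _∷_; lookup)
open import Data.List using (List; []; _∷_; [_]; map; concatMap; filter; length)
open import Data.List.Base using (allFin)
open import Data.Product using (_×_)
open import Data.Integer using (ℤ; +_; -1ℤ; _^_; _*_)
import Data.Integer as ℤ
open import Relation.Binary.PropositionalEquality using (_≡_)
open import Relation.Nullary.Decidable using (Dec; _×-dec_; _→-dec_)

-- A permutation of [1,k] is represented 0-based as a vector of length k
-- with entries in Fin k (value v stands for v+1) which is injective
-- (equivalently bijective, since domain and codomain have size k).

allVecs : (k m : ℕ) → List (Vec (Fin m) k)
allVecs zero    m = [ [] ]
allVecs (suc k) m = concatMap (λ i → map (i ∷_) (allVecs k m)) (allFin m)

IsPerm : ∀ {k} → Vec (Fin k) k → Set
IsPerm {k} v = (i j : Fin k) → lookup v i ≡ lookup v j → i ≡ j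

isPerm? : ∀ {k} (v : Vec (Fin k) k) → Dec (IsPerm v)
isPerm? v = all? λ i → all? λ j → (lookup v i ≟ᶠ lookup v j) →-dec (i ≟ᶠ j)

Perms : ℕ → Set
Perms k = Vec (Fin k) k

Increasing : ∀ {k n} → Vec (Fin n) k → Set
Increasing {k} ι = (a b : Fin k) → a < b → lookup ι a < lookup ι b

increasing? : ∀ {k n} (ι : Vec (Fin n) k) → Dec (Increasing ι)
increasing? ι = all? λ a → all? λ b → (a <? b) →-dec (lookup ι a <? lookup ι b)

OrderIso : ∀ {k n} → Vec (Fin k) k → Vec (Fin n) n → Vec (Fin n) k → Set
OrderIso {k} π τ ι = (a b : Fin k) →
  ((lookup π a < lookup π b → lookup τ (lookup ι a) < lookup τ (lookup ι b)) ×
   (lookup τ (lookup ι a) < lookup τ (lookup ι b) → lookup π a < lookup π b))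

orderIso? : ∀ {k n} (π : Vec (Fin k) k) (τ : Vec (Fin n) n) (ι : Vec (Fin n) k) → Dec (OrderIso π τ ι)
orderIso? π τ ι = all? λ a → all? λ b →
  ((lookup π a <? lookup π b) →-dec (lookup τ (lookup ι a) <? lookup τ (lookup ι b))) ×-dec
  ((lookup τ (lookup ι a) <? lookup τ (lookup ι b)) →-dec (lookup π a <? lookup π b))

occ : ∀ {k n} → Vec (Fin k) k → Vec (Fin n) n → ℕ
occ {k} {n} π τ =
  length (filter (λ ι → increasing? ι ×-dec orderIso? π τ ι) (allVecs k n))

IsLRMax : ∀ {n} → Vec (Fin n) n → Fin n → Set
IsLRMax {n} τ j = (i : Fin n) → i < j → lookup τ i < lookup τ j

lmax : ∀ {n} → Vec (Fin n) n → ℕ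
lmax {n} τ = length (filter (λ j → all? λ i → (i <? j) →-dec (lookup τ i <? lookup τ j)) (allFin n))

PermsEndingIn1 : (k : ℕ) → List (Vec (Fin (suc k)) (suc k))
PermsEndingIn1 k =
  filter (λ π → isPerm? π ×-dec (lookup π (fromℕ k) ≟ᶠ zero)) (allVecs (suc k) (suc k))

sumℤ : List ℤ → ℤ
sumℤ []       = + 0
sumℤ (x ∷ xs) = x ℤ.+ sumℤ xs

levelSum : ∀ {n} → Vec (Fin n) n → ℕ → ℤ
levelSum τ k = sumℤ (map (λ π → (-1ℤ ^ k) * (+ occ π τ)) (PermsEndingIn1 k))

-- Σ over patterns π with 1 ≤ |π| ≤ N and π(|π|) = 1 of (-1)^(|π|-1) π(τ)
truncSum : ∀ {n} → Vec (Fin n) n → ℕ → ℤ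
truncSum τ zero    = + 0
truncSum τ (suc N) = truncSum τ N ℤ.+ levelSum τ N

module Submission where

-- An increasing index tuple i₁ < ⋯ < iₖ < j is an occurrence of exactly one pattern, the
-- standardisation of τ(i₁) ⋯ τ(iₖ) τ(j), and this pattern ends in 1 iff τ(j) is the least of these
-- values.  Hence the patterns of length k + 1 ending in 1 occur in τ Σⱼ #{k-chains in Lⱼ} times in
-- total, where Lⱼ = {i < j : τ(i) > τ(j)}.  For a finite set L and N > |L|, the alternating count
-- A(L) = Σ_{k<N} (−1)ᵏ #{k-chains in L} is 1 if L = ∅ and 0 otherwise: splitting off the least
-- element of a chain gives A(L) = 1 − Σ_{i∈L} A(L ∩ (i, ∞)), and by induction the i-th summand is
-- 1 exactly for i = max L.  Finally, j is a left-to-right maximum iff Lⱼ = ∅.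

import Algebra.Properties.Semiring.Sum
open import Data.Bool.Base using (Bool; true; false; T; not; _∧_; _∨_)
open import Data.Bool.Properties using (T-∧; T-≡; ∧-zeroʳ; ∧-identityʳ)
open import Data.Empty using (⊥-elim)
open import Data.Fin.Base using (Fin; zero; suc; toℕ; fromℕ; fromℕ<; inject₁; punchIn; punchOut; _<_)
open import Data.Fin.Properties
  using (_<?_; _≟_; any?; all?; <-irrefl; <-asym; <-trans; <-cmp; toℕ-injective; toℕ-fromℕ<; toℕ-fromℕ;
         toℕ-inject₁; toℕ<n; ≤fromℕ; punchInᵢ≢i; punchIn-punchOut; punchOut-injective; suc-injective)
open import Data.Fin.Relation.Unary.Top using (View; view; ‵fromℕ; ‵inject₁)
open import Data.List.Base using (List; []; _∷_; _++_; map; filter; concatMap; length; allFin)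
import Data.List.Base
open import Data.List.Properties using (map-++; map-∘)
open import Data.Nat.Base as ℕ using (ℕ; zero; suc; _≤_; z≤n; s≤s)
import Data.Nat.ListAction as List
open import Data.Nat.ListAction.Properties using (sum-++)
import Data.Nat.Properties as ℕ
open import Data.Product.Base using (_×_; _,_; ∃; proj₁; proj₂; map₂)
open import Data.Unit.Base using (tt)
open import Data.Vec.Base using (Vec; []; _∷_; _∷ʳ_; lookup; tabulate)
open import Data.Vec.Properties using (∷-injectiveˡ; ∷-injectiveʳ; lookup∘tabulate; tabulate∘lookup; tabulate-cong)
open import Function.Base using (_∘_; const)
open import Function.Bundles using (_⇔_; mk⇔; Equivalence)
open import Function.Definitions using (Injective)
open import Relation.Binary.Definitions using (tri<; tri≈; tri>)
open import Relation.Binary.PropositionalEquality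
open import Relation.Nullary.Decidable
  using (Dec; yes; no; does; _×-dec_; _→-dec_; ¬?; T?; decidable-stable; dec-true; dec-false; does-⇔)
open import Relation.Nullary.Negation using (¬_; contradiction)
open import Relation.Unary using (Pred; Decidable)

open import Defs

open import Algebra.Properties.Semiring.Sum ℕ.+-*-semiring
  using (sum-syntax; sum-cong-≗; sum-replicate-zero; sum-remove; ∑-distrib-+; ∑-comm; *-distribˡ-sum)

-- ℕ arithmetic is opened only locally, so that the ℤ operators can be opened unqualified further down.
module _ where
  open import Data.Nat.Base using (_+_; _*_)

  -- Indicators and counting

  T-does : ∀ {p} {P : Set p} (P? : Dec P) → T (does P?) ⇔ P
  T-does (yes p) = mk⇔ (const p) (const tt)
  T-does (no ¬p) = mk⇔ (λ ()) (λ p → ¬p p)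

  𝟙 : Bool → ℕ
  𝟙 true  = 1
  𝟙 false = 0

  𝟙-∧ : ∀ a b → 𝟙 (a ∧ b) ≡ 𝟙 a * 𝟙 b
  𝟙-∧ true  b = sym (ℕ.+-identityʳ (𝟙 b))
  𝟙-∧ false b = refl

  𝟙-mono : ∀ {a b} → (T a → T b) → 𝟙 a ≤ 𝟙 b
  𝟙-mono {false}         _   = z≤n
  𝟙-mono {true} {true}   _   = s≤s z≤n
  𝟙-mono {true} {false} a⇒b = ⊥-elim (a⇒b tt)

  𝟙+𝟙-not : ∀ b → 𝟙 b + 𝟙 (not b) ≡ 1
  𝟙+𝟙-not true  = refl
  𝟙+𝟙-not false = refl

  _<ᵇ_ : ∀ {n} → Fin n → Fin n → Bool
  i <ᵇ j = does (i <? j)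

  <ᵇ⇒< : ∀ {n} (i j : Fin n) → T (i <ᵇ j) → i < j
  <ᵇ⇒< i j = ℕ.<ᵇ⇒< (toℕ i) (toℕ j)

  <⇒<ᵇ : ∀ {n} {i j : Fin n} → i < j → T (i <ᵇ j)
  <⇒<ᵇ = ℕ.<⇒<ᵇ

  <ᵇ-irrefl : ∀ {n} (i : Fin n) → (i <ᵇ i) ≡ false
  <ᵇ-irrefl i = dec-false (i <? i) (<-irrefl refl)

  count : ∀ {n} → (Fin n → Bool) → ℕ
  count {n} P = ∑[ i < n ] 𝟙 (P i)

  count-cong : ∀ {n} {P Q : Fin n → Bool} → P ≗ Q → count P ≡ count Q
  count-cong P≗Q = sum-cong-≗ (cong 𝟙 ∘ P≗Q)

  count-false : ∀ n → count {n} (const false) ≡ 0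
  count-false = sum-replicate-zero

  count-true : ∀ n → count {n} (const true) ≡ n
  count-true zero    = refl
  count-true (suc n) = cong suc (count-true n)

  count-mono : ∀ {n} {P Q : Fin n → Bool} → (∀ i → T (P i) → T (Q i)) → count P ≤ count Q
  count-mono {zero}  _   = z≤n
  count-mono {suc n} P⇒Q = ℕ.+-mono-≤ (𝟙-mono (P⇒Q zero)) (count-mono (P⇒Q ∘ suc))

  count-remove : ∀ {n} (P : Fin (suc n) → Bool) i → count P ≡ 𝟙 (P i) + count (P ∘ punchIn i)
  count-remove P i = sum-remove (𝟙 ∘ P)

  count≤n : ∀ {n} (P : Fin n → Bool) → count P ≤ n
  count≤n {n} P = ℕ.≤-trans (count-mono {P = P} {Q = const true} (λ _ _ → tt)) (ℕ.≤-reflexive (count-true n))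

  count-complement : ∀ {n} (P : Fin n → Bool) → count P + count (not ∘ P) ≡ n
  count-complement {n} P = begin
    count P + count (not ∘ P)              ≡⟨ ∑-distrib-+ (𝟙 ∘ P) (𝟙 ∘ not ∘ P) ⟨
    ∑[ i < n ] (𝟙 (P i) + 𝟙 (not (P i)))  ≡⟨ sum-cong-≗ (𝟙+𝟙-not ∘ P) ⟩
    count {n} (const true)                 ≡⟨ count-true n ⟩
    n                                      ∎
    where open ≡-Reasoning

  count-injective : ∀ {m n} {f : Fin m → Fin n} → Injective _≡_ _≡_ f →
                    (P : Fin n → Bool) → count (P ∘ f) ≤ count P
  count-injective {zero}                  _   _ = z≤n
  count-injective {suc m} {zero}  {f}     _   _ with () ← f zero
  count-injective {suc m} {suc n} {f} inj P = begin
    𝟙 (P (f zero)) + count (P ∘ f ∘ suc)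
      ≡⟨ cong (𝟙 (P (f zero)) +_) (count-cong (cong P ∘ sym ∘ punchIn-punchOut ∘ f₀≢)) ⟩
    𝟙 (P (f zero)) + count (P ∘ punchIn (f zero) ∘ g)
      ≤⟨ ℕ.+-monoʳ-≤ _ (count-injective g-injective (P ∘ punchIn (f zero))) ⟩
    𝟙 (P (f zero)) + count (P ∘ punchIn (f zero))
      ≡⟨ count-remove P (f zero) ⟨
    count P ∎
    where
    open ℕ.≤-Reasoning
    f₀≢ : ∀ i → f zero ≢ f (suc i)
    f₀≢ i eq with () ← inj eq
    g : Fin m → Fin n
    g i = punchOut (f₀≢ i)
    g-injective : Injective _≡_ _≡_ g
    g-injective eq = suc-injective (inj (punchOut-injective (f₀≢ _) (f₀≢ _) eq))

  count-<ᵇ : ∀ {n} (v : Fin n) → count (_<ᵇ v) ≡ toℕ v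
  count-<ᵇ {suc n} zero    = count-false n
  count-<ᵇ {suc n} (suc v) = cong suc (count-<ᵇ v)

  -- Sums over all words of a given length

  ∑-point : ∀ {m} {f : Fin m → ℕ} p → (∀ i → i ≢ p → f i ≡ 0) → ∑[ i < m ] f i ≡ f p
  ∑-point {suc m} {f} p f≡0 = begin
    ∑[ i < suc m ] f i
      ≡⟨ sum-remove f ⟩
    f p + ∑[ i < m ] f (punchIn p i)
      ≡⟨ cong (f p +_) (sum-cong-≗ (λ i → f≡0 (punchIn p i) (punchInᵢ≢i p i))) ⟩
    f p + ∑[ i < m ] 0
      ≡⟨ cong (f p +_) (sum-replicate-zero m) ⟩
    f p + 0
      ≡⟨ ℕ.+-identityʳ (f p) ⟩
    f p ∎
    where open ≡-Reasoning

  sumWords : ∀ k {m} → (Vec (Fin m) k → ℕ) → ℕ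
  sumWords zero        f = f []
  sumWords (suc k) {m} f = ∑[ i < m ] sumWords k (f ∘ (i ∷_))

  sumWords-cong : ∀ k {m} {f g : Vec (Fin m) k → ℕ} → f ≗ g → sumWords k f ≡ sumWords k g
  sumWords-cong zero    f≗g = f≗g []
  sumWords-cong (suc k) f≗g = sum-cong-≗ (λ i → sumWords-cong k (f≗g ∘ (i ∷_)))

  sumWords-zero : ∀ k {m} {f : Vec (Fin m) k → ℕ} → (∀ w → f w ≡ 0) → sumWords k f ≡ 0
  sumWords-zero zero        f≡0 = f≡0 []
  sumWords-zero (suc k) {m} f≡0 =
    trans (sum-cong-≗ (λ i → sumWords-zero k (f≡0 ∘ (i ∷_)))) (sum-replicate-zero m)

  sumWords-point : ∀ k {m} {f : Vec (Fin m) k → ℕ} p → (∀ w → w ≢ p → f w ≡ 0) → sumWords k f ≡ f p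
  sumWords-point zero    []      _   = refl
  sumWords-point (suc k) (i ∷ p) f≡0 = trans
    (∑-point i (λ j j≢i → sumWords-zero k (λ w → f≡0 (j ∷ w) (j≢i ∘ ∷-injectiveˡ))))
    (sumWords-point k p (λ w w≢p → f≡0 (i ∷ w) (w≢p ∘ ∷-injectiveʳ)))

  *-distribˡ-sumWords : ∀ k {m} c (f : Vec (Fin m) k → ℕ) → c * sumWords k f ≡ sumWords k (λ w → c * f w)
  *-distribˡ-sumWords zero    c f = refl
  *-distribˡ-sumWords (suc k) c f =
    trans (*-distribˡ-sum c (λ i → sumWords k (f ∘ (i ∷_)))) (sum-cong-≗ (λ i → *-distribˡ-sumWords k c (f ∘ (i ∷_))))

  ∑-sumWords-comm : ∀ {n} k {m} (f : Fin n → Vec (Fin m) k → ℕ) →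
                    ∑[ i < n ] sumWords k (f i) ≡ sumWords k (λ w → ∑[ i < n ] f i w)
  ∑-sumWords-comm zero    f = refl
  ∑-sumWords-comm (suc k) f = trans (∑-comm (λ i j → sumWords k (f i ∘ (j ∷_))))
    (sum-cong-≗ (λ j → ∑-sumWords-comm k (λ i → f i ∘ (j ∷_))))

  sumWords-comm : ∀ k l {m n} (f : Vec (Fin m) k → Vec (Fin n) l → ℕ) →
                  sumWords k (λ v → sumWords l (f v)) ≡ sumWords l (λ w → sumWords k (λ v → f v w))
  sumWords-comm zero    l f = refl
  sumWords-comm (suc k) l f = trans
    (sum-cong-≗ (λ i → sumWords-comm k l (f ∘ (i ∷_))))
    (∑-sumWords-comm l (λ i w → sumWords k (λ v → f (i ∷ v) w)))

  sumWords-∷ʳ : ∀ k {m} (f : Vec (Fin m) (suc k) → ℕ) →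
                sumWords (suc k) f ≡ ∑[ j < m ] sumWords k (λ w → f (w ∷ʳ j))
  sumWords-∷ʳ zero    f = refl
  sumWords-∷ʳ (suc k) f = trans
    (sum-cong-≗ (λ i → sumWords-∷ʳ k (f ∘ (i ∷_))))
    (∑-comm (λ i j → sumWords k (λ w → f (i ∷ (w ∷ʳ j)))))

  sum-map-filter : ∀ {a p} {A : Set a} {P : Pred A p} (P? : Decidable P) (f : A → ℕ) xs →
                   List.sum (map f (filter P? xs)) ≡ List.sum (map (λ x → 𝟙 (does (P? x)) * f x) xs)
  sum-map-filter P? f []       = refl
  sum-map-filter P? f (x ∷ xs) with does (P? x)
  ... | true  = cong₂ _+_ (sym (ℕ.*-identityˡ (f x))) (sum-map-filter P? f xs)
  ... | false = sum-map-filter P? f xs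

  length-filter : ∀ {a p} {A : Set a} {P : Pred A p} (P? : Decidable P) xs →
                  length (filter P? xs) ≡ List.sum (map (𝟙 ∘ does ∘ P?) xs)
  length-filter P? []       = refl
  length-filter P? (x ∷ xs) with does (P? x)
  ... | true  = cong suc (length-filter P? xs)
  ... | false = length-filter P? xs

  sum-map-tabulate : ∀ {a} {A : Set a} {m} (f : A → ℕ) (g : Fin m → A) →
                     List.sum (map f (Data.List.Base.tabulate g)) ≡ ∑[ i < m ] f (g i)
  sum-map-tabulate {m = zero}  f g = refl
  sum-map-tabulate {m = suc m} f g = cong (f (g zero) +_) (sum-map-tabulate f (g ∘ suc))

  sum-map-concatMap : ∀ {a b} {A : Set a} {B : Set b} (f : B → ℕ) (g : A → List B) xs →
                      List.sum (map f (concatMap g xs)) ≡ List.sum (map (List.sum ∘ map f ∘ g) xs)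
  sum-map-concatMap f g []       = refl
  sum-map-concatMap f g (x ∷ xs) = begin
    List.sum (map f (g x ++ concatMap g xs))
      ≡⟨ cong List.sum (map-++ f (g x) (concatMap g xs)) ⟩
    List.sum (map f (g x) ++ map f (concatMap g xs))
      ≡⟨ sum-++ (map f (g x)) (map f (concatMap g xs)) ⟩
    List.sum (map f (g x)) + List.sum (map f (concatMap g xs))
      ≡⟨ cong (List.sum (map f (g x)) +_) (sum-map-concatMap f g xs) ⟩
    List.sum (map f (g x)) + List.sum (map (List.sum ∘ map f ∘ g) xs) ∎
    where open ≡-Reasoning

  sum-map-allVecs : ∀ k {m} (f : Vec (Fin m) k → ℕ) → List.sum (map f (allVecs k m)) ≡ sumWords k f
  sum-map-allVecs zero        f = ℕ.+-identityʳ (f [])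
  sum-map-allVecs (suc k) {m} f = begin
    List.sum (map f (allVecs (suc k) m))
      ≡⟨ sum-map-concatMap f (λ i → map (i ∷_) (allVecs k m)) (allFin m) ⟩
    List.sum (map (λ i → List.sum (map f (map (i ∷_) (allVecs k m)))) (allFin m))
      ≡⟨ sum-map-tabulate (λ i → List.sum (map f (map (i ∷_) (allVecs k m)))) (λ i → i) ⟩
    ∑[ i < m ] List.sum (map f (map (i ∷_) (allVecs k m)))
      ≡⟨ sum-cong-≗ (λ i → cong List.sum (map-∘ {g = f} {f = i ∷_} (allVecs k m))) ⟨
    ∑[ i < m ] List.sum (map (f ∘ (i ∷_)) (allVecs k m))
      ≡⟨ sum-cong-≗ (λ i → sum-map-allVecs k (f ∘ (i ∷_))) ⟩
    sumWords (suc k) f ∎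
    where open ≡-Reasoning

  -- Standardisation

  SameOrder : ∀ {K m n} → (Fin K → Fin m) → (Fin K → Fin n) → Set
  SameOrder f g = ∀ a b → (f a < f b → g a < g b) × (g a < g b → f a < f b)

  sameOrder-respˡ : ∀ {K m n} {f f′ : Fin K → Fin m} {g : Fin K → Fin n} → f ≗ f′ → SameOrder f g → SameOrder f′ g
  sameOrder-respˡ f≗f′ f≅g a b =
    (λ lt → proj₁ (f≅g a b) (subst₂ _<_ (sym (f≗f′ a)) (sym (f≗f′ b)) lt)) ,
    (λ lt → subst₂ _<_ (f≗f′ a) (f≗f′ b) (proj₂ (f≅g a b) lt))

  sameOrder-injective : ∀ {K m n} {f : Fin K → Fin m} {g : Fin K → Fin n} →
                        Injective _≡_ _≡_ g → SameOrder f g → Injective _≡_ _≡_ f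
  sameOrder-injective {f = f} {g} g-inj f≅g {a} {b} fa≡fb with <-cmp (g a) (g b)
  ... | tri< ga<gb _ _ = contradiction (proj₂ (f≅g a b) ga<gb) (<-irrefl fa≡fb)
  ... | tri≈ _ ga≡gb _ = g-inj ga≡gb
  ... | tri> _ _ gb<ga = contradiction (proj₂ (f≅g b a) gb<ga) (<-irrefl (sym fa≡fb))

  rank : ∀ {K n} → (Fin K → Fin n) → Fin K → ℕ
  rank σ a = count (λ b → σ b <ᵇ σ a)

  rank-punchIn : ∀ {K n} (σ : Fin (suc K) → Fin n) a → rank σ a ≡ count (λ b → σ (punchIn a b) <ᵇ σ a)
  rank-punchIn σ a = begin
    rank σ a
      ≡⟨ count-remove (λ b → σ b <ᵇ σ a) a ⟩
    𝟙 (σ a <ᵇ σ a) + count (λ b → σ (punchIn a b) <ᵇ σ a)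
      ≡⟨ cong (λ x → 𝟙 x + count (λ b → σ (punchIn a b) <ᵇ σ a)) (<ᵇ-irrefl (σ a)) ⟩
    count (λ b → σ (punchIn a b) <ᵇ σ a) ∎
    where open ≡-Reasoning

  rank< : ∀ {K n} (σ : Fin K → Fin n) a → rank σ a ℕ.< K
  rank< {suc K} σ a = s≤s (ℕ.≤-trans (ℕ.≤-reflexive (rank-punchIn σ a)) (count≤n _))

  rank-mono : ∀ {K n} (σ : Fin K → Fin n) {a b} → σ a < σ b → rank σ a ℕ.< rank σ b
  rank-mono {suc K} σ {a} {b} σa<σb = begin-strict
    rank σ a
      ≡⟨ rank-punchIn σ a ⟩
    count (λ c → σ (punchIn a c) <ᵇ σ a)
      <⟨ s≤s (count-mono (λ c σc<σa → <⇒<ᵇ (<-trans (<ᵇ⇒< (σ (punchIn a c)) (σ a) σc<σa) σa<σb))) ⟩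
    1 + count (λ c → σ (punchIn a c) <ᵇ σ b)
      ≡⟨ cong (λ x → 𝟙 x + count (λ c → σ (punchIn a c) <ᵇ σ b)) (dec-true (σ a <? σ b) σa<σb) ⟨
    𝟙 (σ a <ᵇ σ b) + count (λ c → σ (punchIn a c) <ᵇ σ b)
      ≡⟨ count-remove (λ c → σ c <ᵇ σ b) a ⟨
    rank σ b ∎
    where open ℕ.≤-Reasoning

  rank-cong : ∀ {K m n} {f : Fin K → Fin m} {g : Fin K → Fin n} → SameOrder f g → rank f ≗ rank g
  rank-cong {f = f} {g} f≅g a = count-cong λ b →
    does-⇔ (mk⇔ (proj₁ (f≅g b a)) (proj₂ (f≅g b a))) (f b <? f a) (g b <? g a)

  -- By injectivity at most toℕ (π a) positions are mapped below π a and at most K ∸ toℕ (π a) are not;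
  -- the two counts add up to K, so both bounds are attained.
  rank-injective : ∀ {K} {π : Fin K → Fin K} → Injective _≡_ _≡_ π → ∀ a → rank π a ≡ toℕ (π a)

  rank-injective {K} {π} π-inj a = ℕ.≤-antisym r≤v v≤r
    where
    open ℕ.≤-Reasoning
    below : Fin K → Bool
    below = _<ᵇ π a
    r v c : ℕ
    r = rank π a
    v = toℕ (π a)
    c = count (not ∘ below)
    r≤v : r ≤ v
    r≤v = ℕ.≤-trans (count-injective π-inj below) (ℕ.≤-reflexive (count-<ᵇ (π a)))
    v≤r : v ≤ r
    v≤r = ℕ.+-cancelʳ-≤ c v r (begin
      v + c                          ≡⟨ cong (_+ c) (count-<ᵇ (π a)) ⟨
      count below + c                ≡⟨ count-complement below ⟩
      K                              ≡⟨ count-complement (below ∘ π) ⟨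
      r + count (not ∘ below ∘ π)    ≤⟨ ℕ.+-monoʳ-≤ r (count-injective π-inj (not ∘ below)) ⟩
      r + c                          ∎)

  std : ∀ {K n} → (Fin K → Fin n) → Fin K → Fin K
  std σ a = fromℕ< (rank< σ a)

  toℕ-std : ∀ {K n} (σ : Fin K → Fin n) a → toℕ (std σ a) ≡ rank σ a
  toℕ-std σ a = toℕ-fromℕ< (rank< σ a)

  std-mono : ∀ {K n} (σ : Fin K → Fin n) {a b} → σ a < σ b → std σ a < std σ b
  std-mono σ {a} {b} σa<σb = subst₂ ℕ._<_ (sym (toℕ-std σ a)) (sym (toℕ-std σ b)) (rank-mono σ σa<σb)

  std-sameOrder : ∀ {K n} {σ : Fin K → Fin n} → Injective _≡_ _≡_ σ → SameOrder (std σ) σ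
  std-sameOrder {σ = σ} σ-inj a b = reflect , std-mono σ
    where
    reflect : std σ a < std σ b → σ a < σ b
    reflect sa<sb with <-cmp (σ a) (σ b)
    ... | tri< σa<σb _ _ = σa<σb
    ... | tri≈ _ σa≡σb _ = contradiction (subst (λ x → std σ a < std σ x) (sym (σ-inj σa≡σb)) sa<sb) (<-irrefl refl)
    ... | tri> _ _ σb<σa = contradiction (std-mono σ σb<σa) (<-asym sa<sb)

  sameOrder⇒≗std : ∀ {K n} {π : Fin K → Fin K} {σ : Fin K → Fin n} →
                   Injective _≡_ _≡_ σ → SameOrder π σ → π ≗ std σ
  sameOrder⇒≗std {π = π} {σ} σ-inj π≅σ a = toℕ-injective (begin
    toℕ (π a)      ≡⟨ rank-injective (sameOrder-injective σ-inj π≅σ) a ⟨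
    rank π a       ≡⟨ rank-cong π≅σ a ⟩
    rank σ a       ≡⟨ toℕ-std σ a ⟨
    toℕ (std σ a)  ∎)
    where open ≡-Reasoning

  std-minimum : ∀ {K n} (σ : Fin K → Fin n) {l} → (∀ b → ¬ σ b < σ l) → toℕ (std σ l) ≡ 0
  std-minimum {K} σ {l} l-min = begin
    toℕ (std σ l)            ≡⟨ toℕ-std σ l ⟩
    rank σ l                 ≡⟨ count-cong (λ b → dec-false (σ b <? σ l) (l-min b)) ⟩
    count {K} (const false)  ≡⟨ count-false K ⟩
    0                        ∎
    where open ≡-Reasoning

  -- Increasing chains in a subset

  Chain : ∀ {k n} → (Fin n → Bool) → Vec (Fin n) k → Set
  Chain X w = Increasing w × (∀ a → T (X (lookup w a)))

  chain? : ∀ {k n} (X : Fin n → Bool) (w : Vec (Fin n) k) → Dec (Chain X w)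
  chain? X w = increasing? w ×-dec all? (λ a → T? (X (lookup w a)))

  chains : ∀ {n} → ℕ → (Fin n → Bool) → ℕ
  chains k X = sumWords k (λ w → 𝟙 (does (chain? X w)))

  above : ∀ {n} → (Fin n → Bool) → Fin n → Fin n → Bool
  above X i x = X x ∧ (i <ᵇ x)

  chain-∷ : ∀ {k n} (X : Fin n → Bool) i (w : Vec (Fin n) k) → Chain X (i ∷ w) ⇔ (T (X i) × Chain (above X i) w)
  chain-∷ X i w = mk⇔ to from
    where
    to : Chain X (i ∷ w) → T (X i) × Chain (above X i) w
    to (inc , in-X) = in-X zero , (λ a b a<b → inc (suc a) (suc b) (s≤s a<b)) ,
                      λ a → Equivalence.from T-∧ (in-X (suc a) , <⇒<ᵇ (inc zero (suc a) (s≤s z≤n)))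
    from : T (X i) × Chain (above X i) w → Chain X (i ∷ w)
    from (Xi , inc , in-above) = inc′ , in-X
      where
      split : ∀ a → T (X (lookup w a)) × T (i <ᵇ lookup w a)
      split a = Equivalence.to T-∧ (in-above a)
      inc′ : Increasing (i ∷ w)
      inc′ zero    (suc b) _         = <ᵇ⇒< i (lookup w b) (proj₂ (split b))
      inc′ (suc a) (suc b) (s≤s a<b) = inc a b a<b
      in-X : ∀ a → T (X (lookup (i ∷ w) a))
      in-X zero    = Xi
      in-X (suc a) = proj₁ (split a)

  chains-zero : ∀ {n} (X : Fin n → Bool) → chains 0 X ≡ 1
  chains-zero X = cong 𝟙 (dec-true (chain? X []) ((λ ()) , (λ ())))

  chains-suc : ∀ {n} k (X : Fin n → Bool) → chains (suc k) X ≡ ∑[ i < n ] (𝟙 (X i) * chains k (above X i))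
  chains-suc k X = sum-cong-≗ λ i → begin
    sumWords k (λ w → 𝟙 (does (chain? X (i ∷ w))))
      ≡⟨ sumWords-cong k (λ w → cong 𝟙 (does-⇔ (chain-∷ X i w) (chain? X (i ∷ w)) (T? (X i) ×-dec chain? (above X i) w))) ⟩
    sumWords k (λ w → 𝟙 (X i ∧ does (chain? (above X i) w)))
      ≡⟨ sumWords-cong k (λ w → 𝟙-∧ (X i) (does (chain? (above X i) w))) ⟩
    sumWords k (λ w → 𝟙 (X i) * 𝟙 (does (chain? (above X i) w)))
      ≡⟨ *-distribˡ-sumWords k (𝟙 (X i)) _ ⟨
    𝟙 (X i) * chains k (above X i) ∎
    where open ≡-Reasoning

  nonempty : ∀ {n} → (Fin n → Bool) → Bool
  nonempty X = does (any? (λ i → T? (X i)))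

  nonempty-cong : ∀ {n} {X Y : Fin n → Bool} → X ≗ Y → nonempty X ≡ nonempty Y
  nonempty-cong {X = X} {Y} X≗Y = does-⇔ (mk⇔ (map₂ (subst T (X≗Y _))) (map₂ (subst T (sym (X≗Y _)))))
    (any? (λ i → T? (X i))) (any? (λ i → T? (Y i)))

  -- 0 is maximal in X iff X ∘ suc is empty, and the other maximal elements of X are those of X ∘ suc.
  count-maximal : ∀ {n} (X : Fin n → Bool) → count (λ i → X i ∧ not (nonempty (above X i))) ≡ 𝟙 (nonempty X)
  count-maximal {zero}  X = refl
  count-maximal {suc n} X = begin
    𝟙 (X zero ∧ not (nonempty (above X zero))) + count (λ i → X (suc i) ∧ not (nonempty (above X (suc i))))
      ≡⟨ cong₂ (λ b c → 𝟙 (X zero ∧ not b) + c) nonempty-above-zero (count-cong nonempty-above-suc) ⟩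
    𝟙 (X zero ∧ not (nonempty (X ∘ suc))) + count (λ i → X (suc i) ∧ not (nonempty (above (X ∘ suc) i)))
      ≡⟨ cong (𝟙 (X zero ∧ not (nonempty (X ∘ suc))) +_) (count-maximal (X ∘ suc)) ⟩
    𝟙 (X zero ∧ not (nonempty (X ∘ suc))) + 𝟙 (nonempty (X ∘ suc))
      ≡⟨ 𝟙-∧-not-+-𝟙 (X zero) (nonempty (X ∘ suc)) ⟩
    𝟙 (X zero ∨ nonempty (X ∘ suc)) ∎
    where
    open ≡-Reasoning
    nonempty-above-zero : nonempty (above X zero) ≡ nonempty (X ∘ suc)
    nonempty-above-zero = trans (cong (_∨ nonempty (λ x → X (suc x) ∧ true)) (∧-zeroʳ (X zero)))
                                (nonempty-cong (∧-identityʳ ∘ X ∘ suc))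
    nonempty-above-suc : ∀ i → X (suc i) ∧ not (nonempty (above X (suc i))) ≡ X (suc i) ∧ not (nonempty (above (X ∘ suc) i))
    nonempty-above-suc i = cong (λ b → X (suc i) ∧ not (b ∨ nonempty (above (X ∘ suc) i))) (∧-zeroʳ (X zero))
    𝟙-∧-not-+-𝟙 : ∀ a b → 𝟙 (a ∧ not b) + 𝟙 b ≡ 𝟙 (a ∨ b)
    𝟙-∧-not-+-𝟙 true  true  = refl
    𝟙-∧-not-+-𝟙 true  false = refl
    𝟙-∧-not-+-𝟙 false true  = refl
    𝟙-∧-not-+-𝟙 false false = refl

  count-above : ∀ {n} (X : Fin n → Bool) {i} → T (X i) → count (above X i) ℕ.< count X
  count-above {suc n} X {i} Xi = begin-strict
    count (above X i)
      ≡⟨ count-remove (above X i) i ⟩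
    𝟙 (X i ∧ (i <ᵇ i)) + count (above X i ∘ punchIn i)
      ≡⟨ cong (λ b → 𝟙 (X i ∧ b) + count (above X i ∘ punchIn i)) (<ᵇ-irrefl i) ⟩
    𝟙 (X i ∧ false) + count (above X i ∘ punchIn i)
      ≡⟨ cong (λ b → 𝟙 b + count (above X i ∘ punchIn i)) (∧-zeroʳ (X i)) ⟩
    count (above X i ∘ punchIn i)
      <⟨ s≤s (count-mono {P = above X i ∘ punchIn i} (λ x → proj₁ ∘ Equivalence.to (T-∧ {X (punchIn i x)}))) ⟩
    1 + count (X ∘ punchIn i)
      ≡⟨ cong (λ b → 𝟙 b + count (X ∘ punchIn i)) (Equivalence.to T-≡ Xi) ⟨
    𝟙 (X i) + count (X ∘ punchIn i)
      ≡⟨ count-remove X i ⟨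
    count X ∎
    where open ℕ.≤-Reasoning

  -- Occurrences of patterns ending in 1

  increasing⇒injective : ∀ {k n} {ι : Vec (Fin n) k} → Increasing ι → Injective _≡_ _≡_ (lookup ι)
  increasing⇒injective {ι = ι} inc {a} {b} ιa≡ιb with <-cmp a b
  ... | tri< a<b _ _ = contradiction (inc a b a<b) (<-irrefl ιa≡ιb)
  ... | tri≈ _ a≡b _ = a≡b
  ... | tri> _ _ b<a = contradiction (inc b a b<a) (<-irrefl (sym ιa≡ιb))

  lookup-∷ʳ-inject₁ : ∀ {a} {A : Set a} {k} (w : Vec A k) x i → lookup (w ∷ʳ x) (inject₁ i) ≡ lookup w i
  lookup-∷ʳ-inject₁ (y ∷ w) x zero    = refl
  lookup-∷ʳ-inject₁ (y ∷ w) x (suc i) = lookup-∷ʳ-inject₁ w x i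

  lookup-∷ʳ-fromℕ : ∀ {a} {A : Set a} {k} (w : Vec A k) x → lookup (w ∷ʳ x) (fromℕ k) ≡ x
  lookup-∷ʳ-fromℕ []      x = refl
  lookup-∷ʳ-fromℕ (y ∷ w) x = lookup-∷ʳ-fromℕ w x

  all-∷ʳ : ∀ {a p} {A : Set a} {k} (P : A → Set p) (w : Vec A k) x →
           (∀ i → P (lookup (w ∷ʳ x) i)) ⇔ ((∀ i → P (lookup w i)) × P x)
  all-∷ʳ {k = k} P w x = mk⇔
    (λ all → (λ i → subst P (lookup-∷ʳ-inject₁ w x i) (all (inject₁ i))) , subst P (lookup-∷ʳ-fromℕ w x) (all (fromℕ k)))
    (λ (all , Px) i → from all Px i (view i))
    where
    from : (∀ i → P (lookup w i)) → P x → ∀ i → View i → P (lookup (w ∷ʳ x) i)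
    from all Px _ ‵fromℕ        = subst P (sym (lookup-∷ʳ-fromℕ w x)) Px
    from all Px _ (‵inject₁ i) = subst P (sym (lookup-∷ʳ-inject₁ w x i)) (all i)

  increasing-∷ʳ : ∀ {k n} (w : Vec (Fin n) k) j → Increasing (w ∷ʳ j) ⇔ (Increasing w × (∀ a → lookup w a < j))
  increasing-∷ʳ {k} {n} w j = mk⇔ to from
    where
    ι : Vec (Fin n) (suc k)
    ι = w ∷ʳ j
    inject₁<fromℕ : ∀ a → inject₁ a < fromℕ k
    inject₁<fromℕ a = subst₂ ℕ._<_ (sym (toℕ-inject₁ a)) (sym (toℕ-fromℕ k)) (toℕ<n a)
    to : Increasing ι → Increasing w × (∀ a → lookup w a < j)
    to inc = (λ a b a<b → subst₂ _<_ (lookup-∷ʳ-inject₁ w j a) (lookup-∷ʳ-inject₁ w j b)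
                            (inc (inject₁ a) (inject₁ b) (subst₂ ℕ._<_ (sym (toℕ-inject₁ a)) (sym (toℕ-inject₁ b)) a<b))) ,
             (λ a → subst₂ _<_ (lookup-∷ʳ-inject₁ w j a) (lookup-∷ʳ-fromℕ w j) (inc (inject₁ a) (fromℕ k) (inject₁<fromℕ a)))
    from′ : Increasing w → (∀ a → lookup w a < j) → ∀ {a b} → View a → View b → a < b → lookup ι a < lookup ι b
    from′ inc w<j ‵fromℕ        _              a<b = contradiction a<b (ℕ.≤⇒≯ (≤fromℕ _))
    from′ inc w<j (‵inject₁ a) ‵fromℕ         _   =
      subst₂ _<_ (sym (lookup-∷ʳ-inject₁ w j a)) (sym (lookup-∷ʳ-fromℕ w j)) (w<j a)
    from′ inc w<j (‵inject₁ a) (‵inject₁ b) a<b =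
      subst₂ _<_ (sym (lookup-∷ʳ-inject₁ w j a)) (sym (lookup-∷ʳ-inject₁ w j b))
        (inc a b (subst₂ ℕ._<_ (toℕ-inject₁ a) (toℕ-inject₁ b) a<b))
    from : Increasing w × (∀ a → lookup w a < j) → Increasing ι
    from (inc , w<j) a b = from′ inc w<j (view a) (view b)

  patternAt : ∀ {k n} → Vec (Fin n) n → Vec (Fin n) k → Vec (Fin k) k
  patternAt τ ι = tabulate (std (λ a → lookup τ (lookup ι a)))

  module _ {k n} (τ : Vec (Fin n) n) (τ-perm : IsPerm τ) (ι : Vec (Fin n) k) (inc : Increasing ι) where

    private
      σ-injective : Injective _≡_ _≡_ (λ a → lookup τ (lookup ι a))
      σ-injective eq = increasing⇒injective {ι = ι} inc (τ-perm _ _ eq)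

    patternAt-orderIso : OrderIso (patternAt τ ι) τ ι
    patternAt-orderIso = sameOrder-respˡ (sym ∘ lookup∘tabulate _) (std-sameOrder σ-injective)

    patternAt-isPerm : IsPerm (patternAt τ ι)
    patternAt-isPerm _ _ = sameOrder-injective σ-injective patternAt-orderIso

    orderIso⇒≡patternAt : ∀ {π} → OrderIso π τ ι → π ≡ patternAt τ ι
    orderIso⇒≡patternAt {π} π≅ = trans (sym (tabulate∘lookup π)) (tabulate-cong (sameOrder⇒≗std σ-injective π≅))

  EndsIn1 : ∀ {k} → Vec (Fin (suc k)) (suc k) → Set
  EndsIn1 {k} π = IsPerm π × lookup π (fromℕ k) ≡ zero

  Occurrence : ∀ {k n} → Vec (Fin k) k → Vec (Fin n) n → Vec (Fin n) k → Set
  Occurrence π τ ι = Increasing ι × OrderIso π τ ι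

  -- Literally the tests by which Defs filters in PermsEndingIn1 and occ.
  endsIn1? : ∀ {k} (π : Vec (Fin (suc k)) (suc k)) → Dec (EndsIn1 π)
  endsIn1? {k} π = isPerm? π ×-dec (lookup π (fromℕ k) ≟ zero)

  occurrence? : ∀ {k n} (π : Vec (Fin k) k) (τ : Vec (Fin n) n) (ι : Vec (Fin n) k) → Dec (Occurrence π τ ι)
  occurrence? π τ ι = increasing? ι ×-dec orderIso? π τ ι

  MinAtEnd : ∀ {k n} → Vec (Fin n) n → Vec (Fin n) (suc k) → Set
  MinAtEnd {k} τ ι = Increasing ι × (∀ a → ¬ lookup τ (lookup ι a) < lookup τ (lookup ι (fromℕ k)))

  minAtEnd? : ∀ {k n} (τ : Vec (Fin n) n) (ι : Vec (Fin n) (suc k)) → Dec (MinAtEnd τ ι)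
  minAtEnd? {k} τ ι = increasing? ι ×-dec all? (λ a → ¬? (lookup τ (lookup ι a) <? lookup τ (lookup ι (fromℕ k))))

  patternAt-endsIn1⇔minAtEnd : ∀ {k n} (τ : Vec (Fin n) n) → IsPerm τ → (ι : Vec (Fin n) (suc k)) →
                               (EndsIn1 (patternAt τ ι) × Occurrence (patternAt τ ι) τ ι) ⇔ MinAtEnd τ ι
  patternAt-endsIn1⇔minAtEnd {k} {n} τ τ-perm ι = mk⇔ to from
    where
    π : Vec (Fin (suc k)) (suc k)
    π = patternAt τ ι
    σ : Fin (suc k) → Fin n
    σ a = lookup τ (lookup ι a)
    to : EndsIn1 π × Occurrence π τ ι → MinAtEnd τ ι
    to ((_ , π-last≡0) , inc , π≅) = inc , λ a lt →
      ℕ.n≮0 (subst (lookup π a <_) π-last≡0 (proj₂ (π≅ a (fromℕ k)) lt))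
    from : MinAtEnd τ ι → EndsIn1 π × Occurrence π τ ι
    from (inc , min) = (patternAt-isPerm τ τ-perm ι inc , π-last≡0) , inc , patternAt-orderIso τ τ-perm ι inc
      where
      π-last≡0 : lookup π (fromℕ k) ≡ zero
      π-last≡0 = trans (lookup∘tabulate (std σ) (fromℕ k)) (toℕ-injective (std-minimum σ min))

  patternsEndingIn1-at : ∀ {k n} (τ : Vec (Fin n) n) → IsPerm τ → (ι : Vec (Fin n) (suc k)) →
    sumWords (suc k) (λ π → 𝟙 (does (endsIn1? π)) * 𝟙 (does (occurrence? π τ ι))) ≡ 𝟙 (does (minAtEnd? τ ι))
  patternsEndingIn1-at {k} τ τ-perm ι = begin
    sumWords (suc k) (λ π → 𝟙 (does (endsIn1? π)) * 𝟙 (does (occurrence? π τ ι)))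
      ≡⟨ sumWords-cong (suc k) (λ π → 𝟙-∧ (does (endsIn1? π)) (does (occurrence? π τ ι))) ⟨
    sumWords (suc k) (λ π → 𝟙 (does (endsIn1? π ×-dec occurrence? π τ ι)))
      ≡⟨ sumWords-point (suc k) π₀ (λ π π≢ → cong 𝟙 (dec-false (endsIn1? π ×-dec occurrence? π τ ι)
           λ (_ , inc , π≅) → π≢ (orderIso⇒≡patternAt τ τ-perm ι inc π≅))) ⟩
    𝟙 (does (endsIn1? π₀ ×-dec occurrence? π₀ τ ι))
      ≡⟨ cong 𝟙 (does-⇔ (patternAt-endsIn1⇔minAtEnd τ τ-perm ι) (endsIn1? π₀ ×-dec occurrence? π₀ τ ι) (minAtEnd? τ ι)) ⟩
    𝟙 (does (minAtEnd? τ ι)) ∎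
    where
    open ≡-Reasoning
    π₀ : Vec (Fin (suc k)) (suc k)
    π₀ = patternAt τ ι

  LeftLarger : ∀ {n} → Vec (Fin n) n → Fin n → Fin n → Set
  LeftLarger τ j i = i < j × ¬ lookup τ i < lookup τ j

  leftLarger? : ∀ {n} (τ : Vec (Fin n) n) j i → Dec (LeftLarger τ j i)
  leftLarger? τ j i = (i <? j) ×-dec ¬? (lookup τ i <? lookup τ j)

  leftLarger : ∀ {n} → Vec (Fin n) n → Fin n → Fin n → Bool
  leftLarger τ j i = does (leftLarger? τ j i)

  minAtEnd-∷ʳ : ∀ {k n} (τ : Vec (Fin n) n) (w : Vec (Fin n) k) j → MinAtEnd τ (w ∷ʳ j) ⇔ Chain (leftLarger τ j) w
  minAtEnd-∷ʳ {k} τ w j = mk⇔ to from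
    where
    NotBelow : Fin _ → Set
    NotBelow i = ¬ lookup τ i < lookup τ j
    minimum⇔ : (∀ a → ¬ lookup τ (lookup (w ∷ʳ j) a) < lookup τ (lookup (w ∷ʳ j) (fromℕ k))) ⇔ (∀ a → NotBelow (lookup (w ∷ʳ j) a))
    minimum⇔ rewrite lookup-∷ʳ-fromℕ w j = mk⇔ (λ h → h) (λ h → h)
    to : MinAtEnd τ (w ∷ʳ j) → Chain (leftLarger τ j) w
    to (inc , min) = incw , λ a → Equivalence.from (T-does (leftLarger? τ j (lookup w a))) (w<j a , notBelow a)
      where
      incw : Increasing w
      incw = proj₁ (Equivalence.to (increasing-∷ʳ w j) inc)
      w<j : ∀ a → lookup w a < j
      w<j = proj₂ (Equivalence.to (increasing-∷ʳ w j) inc)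
      notBelow : ∀ a → NotBelow (lookup w a)
      notBelow = proj₁ (Equivalence.to (all-∷ʳ NotBelow w j) (Equivalence.to minimum⇔ min))
    from : Chain (leftLarger τ j) w → MinAtEnd τ (w ∷ʳ j)
    from (incw , larger) = Equivalence.from (increasing-∷ʳ w j) (incw , proj₁ ∘ split) ,
                           Equivalence.from minimum⇔ (Equivalence.from (all-∷ʳ NotBelow w j) (proj₂ ∘ split , <-irrefl refl))
      where
      split : ∀ a → lookup w a < j × NotBelow (lookup w a)
      split a = Equivalence.to (T-does (leftLarger? τ j (lookup w a))) (larger a)

  occ-sumWords : ∀ {k n} (π : Vec (Fin k) k) (τ : Vec (Fin n) n) → occ π τ ≡ sumWords k (λ ι → 𝟙 (does (occurrence? π τ ι)))
  occ-sumWords {k} {n} π τ =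
    trans (length-filter (occurrence? π τ) (allVecs k n)) (sum-map-allVecs k (λ ι → 𝟙 (does (occurrence? π τ ι))))

  sum-occ-PermsEndingIn1 : ∀ {n} (τ : Vec (Fin n) n) → IsPerm τ → ∀ k →
    List.sum (map (λ π → occ π τ) (PermsEndingIn1 k)) ≡ ∑[ j < n ] chains k (leftLarger τ j)
  sum-occ-PermsEndingIn1 {n} τ τ-perm k = begin
    List.sum (map (λ π → occ π τ) (filter endsIn1? (allVecs (suc k) (suc k))))
      ≡⟨ sum-map-filter endsIn1? (λ π → occ π τ) (allVecs (suc k) (suc k)) ⟩
    List.sum (map (λ π → E π * occ π τ) (allVecs (suc k) (suc k)))
      ≡⟨ sum-map-allVecs (suc k) (λ π → E π * occ π τ) ⟩
    sumWords (suc k) (λ π → E π * occ π τ)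
      ≡⟨ sumWords-cong (suc k) (λ π → trans (cong (E π *_) (occ-sumWords π τ)) (*-distribˡ-sumWords (suc k) (E π) (O π))) ⟩
    sumWords (suc k) (λ π → sumWords (suc k) (λ ι → E π * O π ι))
      ≡⟨ sumWords-comm (suc k) (suc k) (λ π ι → E π * O π ι) ⟩
    sumWords (suc k) (λ ι → sumWords (suc k) (λ π → E π * O π ι))
      ≡⟨ sumWords-cong (suc k) (patternsEndingIn1-at τ τ-perm) ⟩
    sumWords (suc k) (λ ι → 𝟙 (does (minAtEnd? τ ι)))
      ≡⟨ sumWords-∷ʳ k (λ ι → 𝟙 (does (minAtEnd? τ ι))) ⟩
    ∑[ j < n ] sumWords k (λ w → 𝟙 (does (minAtEnd? τ (w ∷ʳ j))))
      ≡⟨ sum-cong-≗ (λ j → sumWords-cong k (λ w → cong 𝟙 (minAtEnd≡chain j w))) ⟩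
    ∑[ j < n ] chains k (leftLarger τ j) ∎
    where
    open ≡-Reasoning
    E : Vec (Fin (suc k)) (suc k) → ℕ
    E π = 𝟙 (does (endsIn1? π))
    O : Vec (Fin (suc k)) (suc k) → Vec (Fin n) (suc k) → ℕ
    O π ι = 𝟙 (does (occurrence? π τ ι))
    minAtEnd≡chain : ∀ j w → does (minAtEnd? τ (w ∷ʳ j)) ≡ does (chain? (leftLarger τ j) w)
    minAtEnd≡chain j w = does-⇔ (minAtEnd-∷ʳ τ w j) (minAtEnd? τ (w ∷ʳ j)) (chain? (leftLarger τ j) w)

  isLRMax⇔no-leftLarger : ∀ {n} (τ : Vec (Fin n) n) j → IsLRMax τ j ⇔ (¬ ∃ λ i → T (leftLarger τ j i))
  isLRMax⇔no-leftLarger τ j = mk⇔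
    (λ lrmax (i , larger) → let (i<j , ¬τi<τj) = Equivalence.to (T-does (leftLarger? τ j i)) larger in ¬τi<τj (lrmax i i<j))
    (λ none i i<j → decidable-stable (lookup τ i <? lookup τ j)
                      (λ ¬τi<τj → none (i , Equivalence.from (T-does (leftLarger? τ j i)) (i<j , ¬τi<τj))))

  count-leftLarger : ∀ {n} (τ : Vec (Fin n) n) j → count (leftLarger τ j) ≤ toℕ j
  count-leftLarger τ j = ℕ.≤-trans
    (count-mono (λ i larger → <⇒<ᵇ (proj₁ (Equivalence.to (T-does (leftLarger? τ j i)) larger))))
    (ℕ.≤-reflexive (count-<ᵇ j))

-- Alternating sums

open import Data.Integer.Base using (ℤ; +_; -1ℤ; _+_; _*_; _-_; _^_)
import Data.Integer.Properties as ℤ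
open import Data.Integer.Tactic.RingSolver using (solve-∀)

module ℤΣ = Algebra.Properties.Semiring.Sum ℤ.+-*-semiring

pos-∑ : ∀ {n} (f : Fin n → ℕ) → + (∑[ i < n ] f i) ≡ ℤΣ.sum (λ i → + f i)
pos-∑ {zero}  f = refl
pos-∑ {suc n} f = trans (ℤ.pos-+ (f zero) _) (cong (_+_ (+ f zero)) (pos-∑ (f ∘ suc)))

sumℤ-map-scale : ∀ {a} {A : Set a} c (f : A → ℕ) xs → sumℤ (map (λ x → c * + f x) xs) ≡ c * + List.sum (map f xs)
sumℤ-map-scale c f []       = sym (ℤ.*-zeroʳ c)
sumℤ-map-scale c f (x ∷ xs) = begin
  c * + f x + sumℤ (map (λ x → c * + f x) xs)  ≡⟨ cong (_+_ (c * + f x)) (sumℤ-map-scale c f xs) ⟩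
  c * + f x + c * + List.sum (map f xs)        ≡⟨ ℤ.*-distribˡ-+ c (+ f x) (+ List.sum (map f xs)) ⟨
  c * (+ f x + + List.sum (map f xs))          ≡⟨ cong (c *_) (ℤ.pos-+ (f x) (List.sum (map f xs))) ⟨
  c * + List.sum (map f (x ∷ xs))              ∎
  where open ≡-Reasoning

alternatingChains : ∀ {n} → ℕ → (Fin n → Bool) → ℤ
alternatingChains zero    X = + 0
alternatingChains (suc N) X = alternatingChains N X + -1ℤ ^ N * + chains N X

alternatingChains-suc : ∀ {n} N (X : Fin n → Bool) →
  alternatingChains (suc N) X ≡ + 1 - ℤΣ.sum (λ i → + 𝟙 (X i) * alternatingChains N (above X i))
alternatingChains-suc {n} zero X = begin
  + 0 + + 1 * + chains 0 X
    ≡⟨ cong (λ c → + 0 + + 1 * + c) (chains-zero X) ⟩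
  + 1
    ≡⟨ cong (+ 1 -_) (trans (ℤΣ.sum-cong-≗ (λ i → ℤ.*-zeroʳ (+ 𝟙 (X i)))) (ℤΣ.sum-replicate-zero n)) ⟨
  + 1 - ℤΣ.sum (λ i → + 𝟙 (X i) * + 0) ∎
  where open ≡-Reasoning
alternatingChains-suc {n} (suc N) X = begin
  alternatingChains (suc N) X + -1ℤ * s * + chains (suc N) X
    ≡⟨ cong₂ (λ a c → a + -1ℤ * s * c) (alternatingChains-suc N X) chains-sucℤ ⟩
  (+ 1 - ℤΣ.sum A) + -1ℤ * s * ℤΣ.sum C
    ≡⟨ regroup (ℤΣ.sum A) (ℤΣ.sum C) s ⟩
  + 1 - (ℤΣ.sum A + s * ℤΣ.sum C)
    ≡⟨ cong (λ c → + 1 - (ℤΣ.sum A + c)) (ℤΣ.*-distribˡ-sum s C) ⟩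
  + 1 - (ℤΣ.sum A + ℤΣ.sum (λ i → s * C i))
    ≡⟨ cong (+ 1 -_) (ℤΣ.∑-distrib-+ A (λ i → s * C i)) ⟨
  + 1 - ℤΣ.sum (λ i → A i + s * C i)
    ≡⟨ cong (+ 1 -_) (ℤΣ.sum-cong-≗ (λ i → factor (+ 𝟙 (X i)) (alternatingChains N (above X i)) s (+ chains N (above X i)))) ⟩
  + 1 - ℤΣ.sum (λ i → + 𝟙 (X i) * alternatingChains (suc N) (above X i)) ∎
  where
  open ≡-Reasoning
  s : ℤ
  s = -1ℤ ^ N
  A C : Fin n → ℤ
  A i = + 𝟙 (X i) * alternatingChains N (above X i)
  C i = + 𝟙 (X i) * + chains N (above X i)
  chains-sucℤ : + chains (suc N) X ≡ ℤΣ.sum C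
  chains-sucℤ = trans (cong +_ (chains-suc N X))
                (trans (pos-∑ (λ i → 𝟙 (X i) ℕ.* chains N (above X i)))
                       (ℤΣ.sum-cong-≗ (λ i → ℤ.pos-* (𝟙 (X i)) (chains N (above X i)))))
  regroup : ∀ a c s → (+ 1 - a) + -1ℤ * s * c ≡ + 1 - (a + s * c)
  regroup = solve-∀
  factor : ∀ x a s c → x * a + s * (x * c) ≡ x * (a + s * c)
  factor = solve-∀

-- By the induction hypothesis the i-th summand of alternatingChains-suc is 1 exactly when i is the maximum of X.
alternatingChains≡𝟙-empty : ∀ {n} N (X : Fin n → Bool) → count X ℕ.< N → alternatingChains N X ≡ + 𝟙 (not (nonempty X))
alternatingChains≡𝟙-empty {n} (suc N) X |X|≤N = begin
  alternatingChains (suc N) X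
    ≡⟨ alternatingChains-suc N X ⟩
  + 1 - ℤΣ.sum (λ i → + 𝟙 (X i) * alternatingChains N (above X i))
    ≡⟨ cong (+ 1 -_) (ℤΣ.sum-cong-≗ summand) ⟩
  + 1 - ℤΣ.sum (λ i → + 𝟙 (maximal i))
    ≡⟨ cong (+ 1 -_) (pos-∑ (𝟙 ∘ maximal)) ⟨
  + 1 - + count maximal
    ≡⟨ cong (λ c → + 1 - + c) (count-maximal X) ⟩
  + 1 - + 𝟙 (nonempty X)
    ≡⟨ 1-𝟙 (nonempty X) ⟩
  + 𝟙 (not (nonempty X)) ∎
  where
  open ≡-Reasoning
  maximal : Fin n → Bool
  maximal i = X i ∧ not (nonempty (above X i))
  summand : ∀ i → + 𝟙 (X i) * alternatingChains N (above X i) ≡ + 𝟙 (maximal i)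
  summand i with X i in Xi
  ... | false = ℤ.*-zeroˡ (alternatingChains N (above X i))
  ... | true  = trans (ℤ.*-identityˡ _) (alternatingChains≡𝟙-empty N (above X i)
                  (ℕ.<-≤-trans (count-above X (Equivalence.from T-≡ Xi)) (ℕ.s≤s⁻¹ |X|≤N)))
  1-𝟙 : ∀ b → + 1 - + 𝟙 b ≡ + 𝟙 (not b)
  1-𝟙 true  = refl
  1-𝟙 false = refl

levelSum-chains : ∀ {n} (τ : Vec (Fin n) n) → IsPerm τ → ∀ N →
                  levelSum τ N ≡ ℤΣ.sum (λ j → -1ℤ ^ N * + chains N (leftLarger τ j))
levelSum-chains τ τ-perm N = begin
  levelSum τ N
    ≡⟨ sumℤ-map-scale (-1ℤ ^ N) (λ π → occ π τ) (PermsEndingIn1 N) ⟩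
  -1ℤ ^ N * + List.sum (map (λ π → occ π τ) (PermsEndingIn1 N))
    ≡⟨ cong (λ c → -1ℤ ^ N * + c) (sum-occ-PermsEndingIn1 τ τ-perm N) ⟩
  -1ℤ ^ N * + (∑[ j < _ ] chains N (leftLarger τ j))
    ≡⟨ cong (-1ℤ ^ N *_) (pos-∑ (λ j → chains N (leftLarger τ j))) ⟩
  -1ℤ ^ N * ℤΣ.sum (λ j → + chains N (leftLarger τ j))
    ≡⟨ ℤΣ.*-distribˡ-sum (-1ℤ ^ N) (λ j → + chains N (leftLarger τ j)) ⟩
  ℤΣ.sum (λ j → -1ℤ ^ N * + chains N (leftLarger τ j)) ∎
  where open ≡-Reasoning

truncSum-alternatingChains : ∀ {n} (τ : Vec (Fin n) n) → IsPerm τ → ∀ N →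
                             truncSum τ N ≡ ℤΣ.sum (λ j → alternatingChains N (leftLarger τ j))
truncSum-alternatingChains {n} τ τ-perm zero    = sym (ℤΣ.sum-replicate-zero n)
truncSum-alternatingChains {n} τ τ-perm (suc N) = begin
  truncSum τ N + levelSum τ N
    ≡⟨ cong₂ _+_ (truncSum-alternatingChains τ τ-perm N) (levelSum-chains τ τ-perm N) ⟩
  ℤΣ.sum (λ j → alternatingChains N (leftLarger τ j)) + ℤΣ.sum (λ j → -1ℤ ^ N * + chains N (leftLarger τ j))
    ≡⟨ ℤΣ.∑-distrib-+ (λ j → alternatingChains N (leftLarger τ j)) (λ j → -1ℤ ^ N * + chains N (leftLarger τ j)) ⟨
  ℤΣ.sum (λ j → alternatingChains (suc N) (leftLarger τ j)) ∎
  where open ≡-Reasoning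

lmax-leftLarger : ∀ {n} (τ : Vec (Fin n) n) → + lmax τ ≡ ℤΣ.sum (λ j → + 𝟙 (not (nonempty (leftLarger τ j))))
lmax-leftLarger {n} τ = trans (cong +_ count-lrmax) (pos-∑ (λ j → 𝟙 (not (nonempty (leftLarger τ j)))))
  where
  lrmax? : ∀ j → Dec (IsLRMax τ j)
  lrmax? j = all? λ i → (i <? j) →-dec (lookup τ i <? lookup τ j)
  count-lrmax : lmax τ ≡ ∑[ j < n ] 𝟙 (not (nonempty (leftLarger τ j)))
  count-lrmax = begin
    length (filter lrmax? (allFin n))
      ≡⟨ length-filter lrmax? (allFin n) ⟩
    List.sum (map (𝟙 ∘ does ∘ lrmax?) (allFin n))
      ≡⟨ sum-map-tabulate (𝟙 ∘ does ∘ lrmax?) (λ j → j) ⟩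
    ∑[ j < n ] 𝟙 (does (lrmax? j))
      ≡⟨ sum-cong-≗ (λ j → cong 𝟙 (does-⇔ (isLRMax⇔no-leftLarger τ j) (lrmax? j) (¬? (any? (λ i → T? (leftLarger τ j i)))))) ⟩
    ∑[ j < n ] 𝟙 (not (nonempty (leftLarger τ j))) ∎
    where open ≡-Reasoning

mainTheorem3 : (n : ℕ) (τ : Vec (Fin n) n) → IsPerm τ →
    (N : ℕ) → n ≤ N → truncSum τ N ≡ + lmax τ
mainTheorem3 n τ τ-perm N n≤N = begin
  truncSum τ N
    ≡⟨ truncSum-alternatingChains τ τ-perm N ⟩
  ℤΣ.sum (λ j → alternatingChains N (leftLarger τ j))
    ≡⟨ ℤΣ.sum-cong-≗ (λ j → alternatingChains≡𝟙-empty N (leftLarger τ j) (|leftLarger|<N j)) ⟩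
  ℤΣ.sum (λ j → + 𝟙 (not (nonempty (leftLarger τ j))))
    ≡⟨ lmax-leftLarger τ ⟨
  + lmax τ ∎
  where
  open ≡-Reasoning
  |leftLarger|<N : ∀ j → count (leftLarger τ j) ℕ.< N
  |leftLarger|<N j = ℕ.≤-<-trans (count-leftLarger τ j) (ℕ.<-≤-trans (toℕ<n j) n≤N)
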